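{- There is an absolute constant $C$ such that for every finite connected undirected unweighted $\gamma$-doubling graph $G$, every ranking $r$ of its node set and every $\varepsilon>0$: (i) among the nodes $u$ selected (in step (1)) by Algorithm R during its first $C\gamma^{\lceil\log_2\frac{2}{\varepsilon}\rceil+1}$ iterations (or all its iterations, if it halts earlier) there is one with $e(u)\le(1+\varepsilon)\mathrm{rad}(G)$; (ii) among the nodes $u$ selected by Algorithm D during its first $C\gamma^{\lceil\log_2\frac{2}{\varepsilon}\rceil+1}$ iterations (or all its iterations, if it halts earlier) there is one with $e(u)\ge(1-\varepsilon)\mathrm{diam}(G)$. In particular each algorithm provides such a node using $O(\gamma^{\lceil\log\frac{2}{\varepsilon}\rceil+1})$ one-to-all distance queries.
   Context: $d$ is shortest-path distance, $e(u)=\max_v d(u,v)$, $\mathrm{rad}(G)=\min_u e(u)$, $\mathrm{diam}(G)=\max_u e(u)$. $G$ is $\gamma$-doubling if every ball $B[u,\rho]=\{v:d(u,v)\le\rho\}$ is contained in the union of at most $\gamma$ balls of radius $\rho/2$. A ranking $r$ is an injective map $V\to\mathbb{N}$; the antipode $a_r(u)$ is the node $v$ maximizing $(d(u,v),r(v))$ lexicographically. $e_L(u)=\max_{x\in L}d(u,x)$ ($0$ if $L=\emptyset$), $e^U(u)=\min_{x\in U}(d(u,x)+e(x))$ ($\infty$ if $U=\emptyset$). A one-to-all distance query from $u$ returns $(d(u,v))_{v}$. Algorithm R: maintain $L$, $e_L$, $K$ (initially empty). Each iteration: (1) choose $u$ minimizing $e_L(u)$; (2) query $u$, compute $e(u)$;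 (3) if $e(u)=e_L(u)$ output $(e(u),u,L)$ and halt; (4) else let $a=a_r(u)$, query $a$, add $u$ to $K$, $a$ to $L$, update $e_L$. After each iteration, halt if $\min_v e_L(v)\ge\min_{w\in K}e(w)$. Algorithm D: maintain $U$, $e^U$, $K$ (initially empty). Each iteration: choose $u$ maximizing $e^U(u)$ (the selected node); query $u$, compute $e(u)$, add $u$ to $K$; choose any $x$ with $d(u,x)+e(x)=e(u)$ (e.g. $x=u$), query $x$, add $x$ to $U$, update $e^U(v):=\min(e^U(v),d(x,v)+e(x))$. After each iteration, halt if $\max_{w\in K}e(w)\ge\max_v e^U(v)$.
   Formalization: The accuracy parameter ε ranges over the positive rationals. -}

module Defs where

open import Data.Nat using (ℕ; zero; suc; _+_; _*_; _^_; _≤_; _<_; _⊔_; _⊓_; _<ᵇ_; _≡ᵇ_; _≤?_; _/_)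
open import Data.Bool using (Bool; true; false; if_then_else_; _∨_; _∧_)
open import Data.Fin using (Fin)
open import Data.List using (List; []; _∷_; foldr; allFin; length)
open import Data.List.Relation.Unary.Any using (Any)
open import Data.Maybe using (Maybe; just; nothing)
open import Data.Product using (Σ; ∃; _×_; _,_)
open import Data.Sum using (_⊎_)
open import Data.Empty using (⊥)
open import Data.Unit using (⊤)
open import Data.Integer using (ℤ; +_; -[1+_]; -_)
open import Relation.Nullary using (¬_; does)
open import Relation.Binary.PropositionalEquality using (_≡_; _≢_)

Symmetric : ∀ {n} → (Fin n → Fin n → Bool) → Set
Symmetric adj = ∀ u v → adj u v ≡ adj v u

Irreflexive : ∀ {n} → (Fin n → Fin n → Bool) → Set
Irreflexive adj = ∀ u → adj u u ≡ false

data Walk {n : ℕ} (adj : Fin n → Fin n → Bool) : Fin n → Fin n → ℕ → Set where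
  here : ∀ {u} → Walk adj u u 0
  step : ∀ {u w v k} → adj u w ≡ true → Walk adj w v k → Walk adj u v (suc k)

Connected : ∀ {n} → (Fin n → Fin n → Bool) → Set
Connected adj = ∀ u v → ∃ λ k → Walk adj u v k

IsShortestPathDist : ∀ {n} → (Fin n → Fin n → Bool) → (Fin n → Fin n → ℕ) → Set
IsShortestPathDist adj d =
  ∀ u v → Walk adj u v (d u v) × (∀ k → Walk adj u v k → d u v ≤ k)

IsRanking : ∀ {n} → (Fin n → ℕ) → Set
IsRanking r = ∀ u v → r u ≡ r v → u ≡ v

module _ {n : ℕ} (d : Fin n → Fin n → ℕ) where

  ecc : Fin n → ℕ
  ecc u = foldr (λ v m → d u v ⊔ m) 0 (allFin n)

  -- closed ball membership / doubling:  every ball B[u,ρ] is covered by at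
  -- most γ balls of radius ρ/2 (v ∈ B[c,ρ/2] iff 2·d(c,v) ≤ ρ).
  -- (Distances are integers, so quantifying over ρ ∈ ℕ is equivalent to ρ ∈ ℝ≥0.)
  Doubling : ℕ → Set
  Doubling γ = ∀ (u : Fin n) (ρ : ℕ) →
    Σ (List (Fin n)) λ cs → length cs ≤ γ ×
      (∀ v → d u v ≤ ρ → Any (λ c → 2 * d c v ≤ ρ) cs)

  eL : List (Fin n) → Fin n → ℕ
  eL L u = foldr (λ x m → d u x ⊔ m) 0 L

  -- extended naturals: nothing = ∞
  minM : Maybe ℕ → Maybe ℕ → Maybe ℕ
  minM nothing b = b
  minM (just a) nothing = just a
  minM (just a) (just b) = just (a ⊓ b)

  _≤M_ : Maybe ℕ → Maybe ℕ → Set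
  _ ≤M nothing = ⊤
  nothing ≤M just _ = ⊥
  just a ≤M just b = a ≤ b

  eU : List (Fin n) → Fin n → Maybe ℕ
  eU U u = foldr (λ x m → minM (just (d u x + ecc x)) m) nothing U

  module _ (r : Fin n → ℕ) where

    lexLt : ℕ → ℕ → ℕ → ℕ → Bool
    lexLt d1 r1 d2 r2 = (d1 <ᵇ d2) ∨ ((d1 ≡ᵇ d2) ∧ (r1 <ᵇ r2))

    antipode : Fin n → Fin n
    antipode u = foldr (λ v best → if lexLt (d u best) (r best) (d u v) (r v)
                                   then v else best) u (allFin n)

    -- A trace is the list of nodes selected in step (1),
    -- in order.  ValidR L K us: us is a legal sequence of iterations
    -- starting from state (L, K) (all but the last iteration did not halt).

    HaltCheckR : List (Fin n) → List (Fin n) → Set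
    -- min_v e_L(v) ≥ min_{w∈K} e(w)
    HaltCheckR L K = Any (λ w → ∀ v → ecc w ≤ eL L v) K

    MinimizesEL : List (Fin n) → Fin n → Set
    MinimizesEL L u = ∀ v → eL L u ≤ eL L v

    ValidR : List (Fin n) → List (Fin n) → List (Fin n) → Set
    ValidR L K [] = ⊤
    ValidR L K (u ∷ []) = MinimizesEL L u
    ValidR L K (u ∷ u' ∷ us) =
      MinimizesEL L u × ecc u ≢ eL L u ×
      ¬ HaltCheckR (antipode u ∷ L) (u ∷ K) × ValidR (antipode u ∷ L) (u ∷ K) (u' ∷ us)

    -- the algorithm halts at the end of the last iteration of the trace
    HaltedR : List (Fin n) → List (Fin n) → List (Fin n) → Set
    HaltedR L K [] = ⊥
    HaltedR L K (u ∷ []) = ecc u ≡ eL L u ⊎ HaltCheckR (antipode u ∷ L) (u ∷ K)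
    HaltedR L K (u ∷ u' ∷ us) = HaltedR (antipode u ∷ L) (u ∷ K) (u' ∷ us)

  -- Algorithm D.  A trace is the list of pairs (u , x) of the selected
  -- node u and the chosen node x with d(u,x)+e(x)=e(u), in order.

  HaltCheckD : List (Fin n) → List (Fin n) → Set
  -- max_{w∈K} e(w) ≥ max_v e^U(v)
  HaltCheckD U K = Any (λ w → ∀ v → eU U v ≤M just (ecc w)) K

  MaximizesEU : List (Fin n) → Fin n → Set
  MaximizesEU U u = ∀ v → eU U v ≤M eU U u

  ValidD : List (Fin n) → List (Fin n) → List (Fin n × Fin n) → Set
  ValidD U K [] = ⊤
  ValidD U K ((u , x) ∷ []) = MaximizesEU U u × d u x + ecc x ≡ ecc u
  ValidD U K ((u , x) ∷ p ∷ ps) =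
    MaximizesEU U u × d u x + ecc x ≡ ecc u ×
    ¬ HaltCheckD (x ∷ U) (u ∷ K) × ValidD (x ∷ U) (u ∷ K) (p ∷ ps)

  HaltedD : List (Fin n) → List (Fin n) → List (Fin n × Fin n) → Set
  HaltedD U K [] = ⊥
  HaltedD U K ((u , x) ∷ []) = HaltCheckD (x ∷ U) (u ∷ K)
  HaltedD U K ((u , x) ∷ p ∷ ps) = HaltedD (x ∷ U) (u ∷ K) (p ∷ ps)

rad : ∀ {m} → (Fin (suc m) → Fin (suc m) → ℕ) → ℕ
rad {m} d = foldr (λ u k → ecc d u ⊓ k) (ecc d Fin.zero) (allFin (suc m))

diam : ∀ {m} → (Fin (suc m) → Fin (suc m) → ℕ) → ℕ
diam {m} d = foldr (λ u k → ecc d u ⊔ k) 0 (allFin (suc m))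

-- ⌈log₂(a/b)⌉ for a, b ≥ 1, as an integer.

-- least k ≥ k0 with a ≤ 2^k * b (fuel-bounded search; fuel a suffices from 0)
leastK : ℕ → ℕ → ℕ → ℕ → ℕ
leastK a b zero k = k
leastK a b (suc f) k = if does (a ≤? 2 ^ k * b) then k else leastK a b f (suc k)

-- largest j ≥ j0 with 2^j * a ≤ b (fuel b suffices from 0)
largestJ : ℕ → ℕ → ℕ → ℕ → ℕ
largestJ a b zero j = j
largestJ a b (suc f) j = if does (2 ^ suc j * a ≤? b) then largestJ a b f (suc j) else j

ceilLog2Frac : ℕ → ℕ → ℤ
ceilLog2Frac a b = if does (b ≤? a) then + leastK a b a 0 else - (+ largestJ a b b 0)

-- ⌈a / b⌉ (b = 0 never occurs in use)
ceilDiv : ℕ → ℕ → ℕ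
ceilDiv a zero = a
ceilDiv a (suc b) = (a + b) / suc b

-- number of iterations ⌈C · γ^t⌉ for an integer exponent t
iterBound : ℕ → ℕ → ℤ → ℕ
iterBound C γ (+ k) = C * γ ^ k
iterBound C γ -[1+ k ] = ceilDiv C (γ ^ suc k)

-- If an algorithm halts by its own test, that test applied to a centre (for R) or to a
-- peripheral node (for D) certifies that some selected node is already optimal.  Otherwise
-- suppose all selected nodes of a full run are bad.  For R, a selected node u minimises e_L,
-- so it lies within rad of every earlier antipode, and e(u) > (1+ε)·rad forces its own
-- antipode to be more than ε·rad from each of them.  For D, e^U(u) ≥ e^U(s) ≥ diam for the
-- selected u and a peripheral s, so a bad earlier node is more than ε·diam from u.  These
-- pairwise separated points lie in one ball of radius rad (resp. diam); applying the doubling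
-- property t = ⌈log₂(2/ε)⌉ times covers it by γ^t balls each holding at most one of them, so
-- there are at most γ^t of them, fewer than the 2·γ^(t+1) iterations of the run.  For ε > 2
-- every node is good.

module Submission where

open import Defs
open import Data.Nat
  using (ℕ; zero; suc; _+_; _*_; _^_; _≤_; _<_; _⊔_; _⊓_; _≤ᵇ_; _≤?_; _/_; z≤n; s≤s; NonZero; >-nonZero)
open import Data.Nat.Properties
open import Algebra.Properties.CommutativeSemigroup *-commutativeSemigroup using (x∙yz≈y∙xz)
open import Data.Nat.DivMod using (m*n/n≡m; m/n*n≤m; /-monoˡ-≤; m≥n⇒m/n>0)
open import Data.Bool using (Bool; true; false; if_then_else_; T)
open import Data.Bool.Properties using (T-∨; T-∧)
open import Data.Fin using (Fin)
open import Data.Maybe using (Maybe; just; nothing)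
open import Data.List using (List; []; _∷_; foldr; allFin; length; map; concatMap)
open import Data.List.Properties using (length-++; length-map; length-removeAt′)
open import Data.List.Relation.Unary.Any using (Any; here; there; any?; _─_)
import Data.List.Relation.Unary.Any as Any
open import Data.List.Relation.Unary.Any.Properties using (concat⁺; map⁺)
open import Data.List.Relation.Unary.All using (All; []; _∷_)
import Data.List.Relation.Unary.All as All
open import Data.List.Relation.Unary.All.Properties using (¬Any⇒All¬) renaming (map⁺ to All-map⁺)
open import Data.List.Relation.Unary.AllPairs using (AllPairs; []; _∷_)
open import Data.List.Membership.Propositional using (_∈_)
open import Data.List.Membership.Propositional.Properties using (∈-allFin)
open import Data.Integer using (-[1+_]) renaming (_+_ to _+ℤ_; +_ to ⁺_)
open import Data.Product using (Σ; ∃; _×_; _,_; proj₁; proj₂)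
open import Data.Sum using (_⊎_; inj₁; inj₂)
open import Data.Empty using (⊥-elim)
open import Data.Unit using (tt)
open import Function using (_∘′_; Equivalence)
open import Relation.Nullary using (¬_; yes; no)
open import Relation.Unary using (Decidable; ∁)
open import Relation.Binary.PropositionalEquality

module _ {A : Set} (f : A → ℕ) where

  foldr-⊔-upper : ∀ z {xs x} → x ∈ xs → f x ≤ foldr (λ v m → f v ⊔ m) z xs
  foldr-⊔-upper z {y ∷ xs} (here refl) = m≤m⊔n (f y) _
  foldr-⊔-upper z {y ∷ xs} (there x∈xs) = ≤-trans (foldr-⊔-upper z x∈xs) (m≤n⊔m (f y) _)

  foldr-⊔-lub : ∀ {z B} xs → (∀ {x} → x ∈ xs → f x ≤ B) → z ≤ B → foldr (λ v m → f v ⊔ m) z xs ≤ B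
  foldr-⊔-lub [] bound z≤B = z≤B
  foldr-⊔-lub (y ∷ xs) bound z≤B = ⊔-lub (bound (here refl)) (foldr-⊔-lub xs (bound ∘′ there) z≤B)

  foldr-⊔-attained : A → ∀ xs → ∃ λ c → foldr (λ v m → f v ⊔ m) 0 xs ≤ f c
  foldr-⊔-attained c₀ [] = c₀ , z≤n
  foldr-⊔-attained c₀ (y ∷ xs) with ⊔-sel (f y) (foldr (λ v m → f v ⊔ m) 0 xs)
  ... | inj₁ eq = y , ≤-reflexive eq
  ... | inj₂ eq = let (c , le) = foldr-⊔-attained c₀ xs in c , subst (_≤ f c) (sym eq) le

  foldr-⊓-attained : ∀ c₀ xs → ∃ λ c → f c ≤ foldr (λ v m → f v ⊓ m) (f c₀) xs
  foldr-⊓-attained c₀ [] = c₀ , ≤-refl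
  foldr-⊓-attained c₀ (y ∷ xs) with ⊓-sel (f y) (foldr (λ v m → f v ⊓ m) (f c₀) xs)
  ... | inj₁ eq = y , ≤-reflexive (sym eq)
  ... | inj₂ eq = let (c , le) = foldr-⊓-attained c₀ xs in c , subst (f c ≤_) (sym eq) le

module ShortestPath {n : ℕ} {adj : Fin n → Fin n → Bool} {d : Fin n → Fin n → ℕ}
  (sym-adj : Symmetric adj) (spd : IsShortestPathDist adj d) where

  walk-++ : ∀ {u w v k l} → Walk adj u w k → Walk adj w v l → Walk adj u v (k + l)
  walk-++ here q = q
  walk-++ (step e p) q = step e (walk-++ p q)

  walk-reverse : ∀ {u v k} → Walk adj u v k → Walk adj v u k
  walk-reverse {k = k} p = subst (Walk adj _ _) (+-identityʳ k) (go p here)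
    where
      go : ∀ {a b c k l} → Walk adj a b k → Walk adj a c l → Walk adj b c (k + l)
      go here acc = acc
      go {l = l} (step {w = w} {k = k} e p) acc =
        subst (Walk adj _ _) (+-suc k l) (go p (step (trans (sym-adj w _) e) acc))

  d-shortest : ∀ {u v k} → Walk adj u v k → d u v ≤ k
  d-shortest = proj₂ (spd _ _) _

  d-refl : ∀ u → d u u ≡ 0
  d-refl u = n≤0⇒n≡0 (d-shortest here)

  d-sym : ∀ u v → d u v ≡ d v u
  d-sym u v = ≤-antisym (d-shortest (walk-reverse (proj₁ (spd v u))))
                        (d-shortest (walk-reverse (proj₁ (spd u v))))

  d-triangle : ∀ u w v → d u v ≤ d u w + d w v
  d-triangle u w v = d-shortest (walk-++ (proj₁ (spd u w)) (proj₁ (spd w v)))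

  d≤ecc : ∀ u v → d u v ≤ ecc d u
  d≤ecc u v = foldr-⊔-upper (d u) 0 (∈-allFin v)

  ecc-lub : ∀ u {B} → (∀ v → d u v ≤ B) → ecc d u ≤ B
  ecc-lub u bound = foldr-⊔-lub (d u) (allFin n) (λ {v} _ → bound v) z≤n

  ecc-triangle : ∀ u x → ecc d u ≤ d u x + ecc d x
  ecc-triangle u x = ecc-lub u (λ v → ≤-trans (d-triangle u x v) (+-monoʳ-≤ (d u x) (d≤ecc x v)))

  eL≤ecc : ∀ L u → eL d L u ≤ ecc d u
  eL≤ecc L u = foldr-⊔-lub (d u) L (λ {x} _ → d≤ecc u x) z≤n

  d≤eL : ∀ {L x} u → x ∈ L → d u x ≤ eL d L u
  d≤eL u x∈L = foldr-⊔-upper (d u) 0 x∈L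

module _ {n : ℕ} (d : Fin n → Fin n → ℕ) (r : Fin n → ℕ) where

  lexLt⇒≤ : ∀ {a b c e} → T (lexLt d r a b c e) → a ≤ c
  lexLt⇒≤ {a} {c = c} t with Equivalence.to T-∨ t
  ... | inj₁ a<c = <⇒≤ (<ᵇ⇒< a c a<c)
  ... | inj₂ a≡c∧ = ≤-reflexive (≡ᵇ⇒≡ a c (proj₁ (Equivalence.to T-∧ a≡c∧)))

  ¬lexLt⇒≥ : ∀ {a b c e} → ¬ T (lexLt d r a b c e) → c ≤ a
  ¬lexLt⇒≥ ¬t = ≮⇒≥ (λ a<c → ¬t (Equivalence.from T-∨ (inj₁ (<⇒<ᵇ a<c))))

  antipode-farthest : ∀ u v → d u v ≤ d u (antipode d r u)
  antipode-farthest u v = go (∈-allFin v)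
    where
      better : Fin n → Fin n → Fin n
      better v best = if lexLt d r (d u best) (r best) (d u v) (r v) then v else best

      better-≥ : ∀ v best → d u v ≤ d u (better v best) × d u best ≤ d u (better v best)
      better-≥ v best with lexLt d r (d u best) (r best) (d u v) (r v) in eq
      ... | true  = ≤-refl , lexLt⇒≤ {b = r best} {e = r v} (subst T (sym eq) tt)
      ... | false = ¬lexLt⇒≥ {b = r best} {e = r v} (subst T eq) , ≤-refl

      go : ∀ {xs x} → x ∈ xs → d u x ≤ d u (foldr better u xs)
      go {y ∷ xs} (here refl) = proj₁ (better-≥ y (foldr better u xs))
      go {y ∷ xs} (there x∈xs) = ≤-trans (go x∈xs) (proj₂ (better-≥ y (foldr better u xs)))

2*m≤n⇒m≤n/2 : ∀ {m n} → 2 * m ≤ n → m ≤ n / 2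
2*m≤n⇒m≤n/2 {m} {n} le = subst (_≤ n / 2) (m*n/n≡m m 2) (/-monoˡ-≤ 2 (subst (_≤ n) (*-comm 2 m) le))

m≤n/2⇒2*m≤n : ∀ {m n} → m ≤ n / 2 → 2 * m ≤ n
m≤n/2⇒2*m≤n {m} {n} le = ≤-trans (*-monoʳ-≤ 2 le) (subst (_≤ n) (*-comm (n / 2) 2) (m/n*n≤m n 2))

length-concatMap≤ : ∀ {A B : Set} {k} (f : A → List B) → (∀ x → length (f x) ≤ k) →
                    ∀ xs → length (concatMap f xs) ≤ length xs * k
length-concatMap≤ f bound [] = z≤n
length-concatMap≤ f bound (x ∷ xs) = subst (_≤ _) (sym (length-++ (f x)))
  (+-mono-≤ (bound x) (length-concatMap≤ f bound xs))

module _ {n : ℕ} (d : Fin n → Fin n → ℕ) {γ : ℕ} (doubling : Doubling d γ) where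

  CoversBall : ℕ → Fin n → ℕ → List (Fin n) → Set
  CoversBall t u ρ cs = ∀ v → d u v ≤ ρ → Any (λ c → 2 ^ t * d c v ≤ ρ) cs

  doubling-iterate : ∀ t u ρ → Σ (List (Fin n)) λ cs → length cs ≤ γ ^ t × CoversBall t u ρ cs
  doubling-iterate zero u ρ = u ∷ [] , ≤-refl , λ v le → here (subst (_≤ ρ) (sym (*-identityˡ (d u v))) le)
  doubling-iterate (suc t) u ρ with doubling u ρ
  ... | cs₀ , len₀ , cover₀ =
    concatMap centres cs₀ ,
    ≤-trans (length-concatMap≤ centres (λ c → proj₁ (proj₂ (sub c))) cs₀) (*-monoˡ-≤ (γ ^ t) len₀) ,
    λ v le → concat⁺ (map⁺ (Any.map (λ {c} → refine v) (cover₀ v le)))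
    where
      sub : ∀ c → Σ (List (Fin n)) λ cs → length cs ≤ γ ^ t × CoversBall t c (ρ / 2) cs
      sub c = doubling-iterate t c (ρ / 2)

      centres : Fin n → List (Fin n)
      centres c = proj₁ (sub c)

      refine : ∀ v {c} → 2 * d c v ≤ ρ → Any (λ c′ → 2 ^ suc t * d c′ v ≤ ρ) (centres c)
      refine v {c} le = Any.map (λ {c′} le′ → subst (_≤ ρ) (sym (*-assoc 2 (2 ^ t) (d c′ v))) (m≤n/2⇒2*m≤n le′))
                               (proj₂ (proj₂ (sub c)) v (2*m≤n⇒m≤n/2 le))

module _ {A : Set} {P Q : A → Set} where

  Any-─ : ∀ {xs} (p : Any P xs) → (∀ {x} → P x → ¬ Q x) → Any Q xs → Any Q (xs ─ p)
  Any-─ (here px) excl (here qx) = ⊥-elim (excl px qx)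
  Any-─ (here px) excl (there q) = q
  Any-─ (there p) excl (here qx) = here qx
  Any-─ (there p) excl (there q) = there (Any-─ p excl q)

pigeonhole : {A : Set} (Far Close : A → A → Set) →
             (∀ {a b x} → Far a b → Close a x → ¬ Close b x) →
             ∀ {as cs} → AllPairs Far as → All (λ a → Any (Close a) cs) as → length as ≤ length cs
pigeonhole Far Close excl {[]} [] [] = z≤n
pigeonhole Far Close excl {a ∷ as} {cs} (far ∷ pairs) (close ∷ closes) =
  subst (suc (length as) ≤_) (sym (length-removeAt′ cs (Any.index close)))
    (s≤s (pigeonhole Far Close excl pairs (All.zipWith (λ (f , c) → Any-─ close (excl f) c) (far , closes))))

Any⇒1≤length : ∀ {A : Set} {P : A → Set} {xs} → Any P xs → 1 ≤ length xs
Any⇒1≤length (here _) = s≤s z≤n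
Any⇒1≤length (there _) = s≤s z≤n

1≤length⇒Any : ∀ {A : Set} {P : A → Set} {xs} → (∀ x → P x) → 1 ≤ length xs → Any P xs
1≤length⇒Any {xs = x ∷ _} all _ = here (all x)

n<2^n : ∀ n → n < 2 ^ n
n<2^n zero = s≤s z≤n
n<2^n (suc n) = subst₂ _≤_ (+-comm (suc n) 1) (cong (2 ^ n +_) (sym (+-identityʳ (2 ^ n))))
  (+-mono-≤ (n<2^n n) (m^n>0 2 n))

m^n<2*m^[1+n] : ∀ {m} n → 1 ≤ m → m ^ n < 2 * m ^ suc n
m^n<2*m^[1+n] {m} n 1≤m = begin-strict
  m ^ n         ≤⟨ m≤n*m (m ^ n) m ⟩
  m ^ suc n     <⟨ m<m*n (m ^ suc n) 2 ≤-refl ⟩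
  m ^ suc n * 2 ≡⟨ *-comm (m ^ suc n) 2 ⟩
  2 * m ^ suc n ∎
  where
    open ≤-Reasoning
    instance
      m≢0 : NonZero m
      m≢0 = >-nonZero 1≤m
      m^[1+n]≢0 : NonZero (m ^ suc n)
      m^[1+n]≢0 = m^n≢0 m (suc n)

leastK-sound : ∀ a b f k → a ≤ 2 ^ (f + k) * b → a ≤ 2 ^ leastK a b f k * b
leastK-sound a b zero k le = le
leastK-sound a b (suc f) k le with a ≤ᵇ 2 ^ k * b in found
... | true = ≤ᵇ⇒≤ a (2 ^ k * b) (subst T (sym found) tt)
... | false = leastK-sound a b f (suc k) (subst (λ e → a ≤ 2 ^ e * b) (sym (+-suc f k)) le)

ceilLog2Frac-upper : ∀ {a b} → 1 ≤ b → b ≤ a → ∃ λ k → a ≤ 2 ^ k * b × ceilLog2Frac a b ≡ ⁺ k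
ceilLog2Frac-upper {a} {b} 1≤b b≤a with b ≤ᵇ a in b≤ᵇa
... | false = ⊥-elim (subst T b≤ᵇa (≤⇒≤ᵇ b≤a))
... | true = leastK a b a 0 , leastK-sound a b a 0 a≤2^a*b , refl
  where
    instance
      b≢0 : NonZero b
      b≢0 = >-nonZero 1≤b
    a≤2^a*b : a ≤ 2 ^ (a + 0) * b
    a≤2^a*b = subst (λ e → a ≤ 2 ^ e * b) (sym (+-identityʳ a))
      (≤-trans (<⇒≤ (n<2^n a)) (m≤m*n (2 ^ a) b))

iterBound-positive : ∀ {C γ} → 1 ≤ C → 1 ≤ γ → ∀ z → 1 ≤ iterBound C γ z
iterBound-positive {C} {γ} 1≤C 1≤γ (⁺ k) = *-mono-≤ 1≤C (m^n>0 γ {{>-nonZero 1≤γ}} k)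
iterBound-positive {C} {γ} 1≤C 1≤γ -[1+ k ] with γ ^ suc k | m^n>0 γ {{>-nonZero 1≤γ}} (suc k)
... | suc b | _ = m≥n⇒m/n>0 {C + b} {suc b} (+-monoˡ-≤ b 1≤C)

-- d a b > ε · ρ for ε = p / q.
Separated : ∀ {n} → (Fin n → Fin n → ℕ) → ℕ → ℕ → ℕ → Fin n → Fin n → Set
Separated d p q ρ a b = p * ρ < q * d a b

module Packing {n : ℕ} {adj : Fin n → Fin n → Bool} {d : Fin n → Fin n → ℕ}
  (sym-adj : Symmetric adj) (spd : IsShortestPathDist adj d)
  {γ : ℕ} (doubling : Doubling d γ) (p q : ℕ) where

  open ShortestPath sym-adj spd

  separated⇒¬both-close : ∀ {t ρ a b x} → 2 * q ≤ 2 ^ t * p → Separated d p q ρ a b →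
                          2 ^ t * d x a ≤ ρ → ¬ 2 ^ t * d x b ≤ ρ
  separated⇒¬both-close {t} {ρ} {a} {b} {x} 2q≤ sep close-a close-b = <-irrefl refl (begin-strict
    K * (p * ρ)       <⟨ *-monoʳ-< K sep ⟩
    K * (q * d a b)   ≡⟨ x∙yz≈y∙xz K q (d a b) ⟩
    q * (K * d a b)   ≤⟨ *-monoʳ-≤ q diameter ⟩
    q * (2 * ρ)       ≡⟨ trans (x∙yz≈y∙xz q 2 ρ) (sym (*-assoc 2 q ρ)) ⟩
    2 * q * ρ         ≤⟨ *-monoˡ-≤ ρ 2q≤ ⟩
    K * p * ρ         ≡⟨ *-assoc K p ρ ⟩
    K * (p * ρ)       ∎)
    where
      open ≤-Reasoning
      K : ℕ
      K = 2 ^ t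
      instance
        K≢0 : NonZero K
        K≢0 = >-nonZero (m^n>0 2 t)
      diameter : K * d a b ≤ 2 * ρ
      diameter = begin
        K * d a b           ≤⟨ *-monoʳ-≤ K (d-triangle a x b) ⟩
        K * (d a x + d x b) ≡⟨ cong (λ e → K * (e + d x b)) (d-sym a x) ⟩
        K * (d x a + d x b) ≡⟨ *-distribˡ-+ K (d x a) (d x b) ⟩
        K * d x a + K * d x b ≤⟨ +-mono-≤ close-a close-b ⟩
        ρ + ρ               ≡⟨ cong (ρ +_) (sym (+-identityʳ ρ)) ⟩
        2 * ρ               ∎

  separated-in-ball-bounded : ∀ {t} → 2 * q ≤ 2 ^ t * p → ∀ c ρ {as} →
                              All (λ a → d c a ≤ ρ) as → AllPairs (Separated d p q ρ) as → length as ≤ γ ^ t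
  separated-in-ball-bounded {t} 2q≤ c ρ in-ball sep with doubling-iterate d doubling t c ρ
  ... | cs , len , covers =
    ≤-trans (pigeonhole (Separated d p q ρ) (λ a x → 2 ^ t * d x a ≤ ρ) (separated⇒¬both-close {t} 2q≤) sep
                        (All.map (covers _) in-ball))
            len

  doubling⇒1≤γ : Fin n → 1 ≤ γ
  doubling⇒1≤γ c with doubling c 0
  ... | cs , len , covers = ≤-trans (Any⇒1≤length (covers c (≤-reflexive (d-refl c)))) len

  budget-exhausted : 1 ≤ p → {A : Set} {Good : A → Set} → Decidable Good → (q ≤ p → ∀ x → Good x) →
    (pt : A → Fin n) (c : Fin n) (ρ : ℕ) → (∀ x → d c (pt x) ≤ ρ) →
    ∀ xs → (All (∁ Good) xs → AllPairs (Separated d p q ρ) (map pt xs)) →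
    length xs ≡ iterBound 2 γ (ceilLog2Frac (2 * q) p +ℤ ⁺ 1) → Any Good xs
  budget-exhausted 1≤p good? all-good pt c ρ in-ball xs separated len with any? good? xs
  ... | yes found = found
  ... | no none with p ≤? 2 * q
  ...   | no p≰2q = 1≤length⇒Any (all-good q≤p)
                       (subst (1 ≤_) (sym len) (iterBound-positive (s≤s z≤n) 1≤γ (ceilLog2Frac (2 * q) p +ℤ ⁺ 1)))
    where
      -- ε > 2: the exponent may be negative, but the budget is still at least one iteration.
      1≤γ : 1 ≤ γ
      1≤γ = doubling⇒1≤γ c
      q≤p : q ≤ p
      q≤p = ≤-trans (m≤m+n q (q + 0)) (<⇒≤ (≰⇒> p≰2q))
  ...   | yes p≤2q with ceilLog2Frac-upper 1≤p p≤2q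
  ...     | k , 2q≤ , ceil≡k = ⊥-elim (<⇒≱ (m^n<2*m^[1+n] k (doubling⇒1≤γ c)) too-many)
    where
      open ≤-Reasoning
      too-many : 2 * γ ^ suc k ≤ γ ^ k
      too-many = begin
        2 * γ ^ suc k                                       ≡⟨ cong (λ e → 2 * γ ^ e) (+-comm 1 k) ⟩
        iterBound 2 γ (⁺ k +ℤ ⁺ 1)                          ≡⟨ cong (λ e → iterBound 2 γ (e +ℤ ⁺ 1)) (sym ceil≡k) ⟩
        iterBound 2 γ (ceilLog2Frac (2 * q) p +ℤ ⁺ 1)       ≡⟨ sym len ⟩
        length xs                                           ≡⟨ sym (length-map pt xs) ⟩
        length (map pt xs)                                  ≤⟨ separated-in-ball-bounded {k} 2q≤ c ρ
                                                                 (All-map⁺ (All.universal in-ball xs))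
                                                                 (separated (¬Any⇒All¬ xs none)) ⟩
        γ ^ k                                               ∎

module AlgorithmR {m : ℕ} {adj : Fin (suc m) → Fin (suc m) → Bool} {d : Fin (suc m) → Fin (suc m) → ℕ}
  (r : Fin (suc m) → ℕ) (sym-adj : Symmetric adj) (spd : IsShortestPathDist adj d) where

  open ShortestPath sym-adj spd

  Central : Fin (suc m) → Set
  Central u = ecc d u ≤ rad d

  centre : ∃ Central
  centre = foldr-⊓-attained (ecc d) Fin.zero (allFin (suc m))

  c : Fin (suc m)
  c = proj₁ centre

  eL-centre≤rad : ∀ L → eL d L c ≤ rad d
  eL-centre≤rad L = ≤-trans (eL≤ecc L c) (proj₂ centre)

  eL-lower-bound⇒central : ∀ L {w} → (∀ v → ecc d w ≤ eL d L v) → Central w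
  eL-lower-bound⇒central L bound = ≤-trans (bound c) (eL-centre≤rad L)

  validR-head : ∀ {L K u us} → ValidR d r L K (u ∷ us) → MinimizesEL d r L u
  validR-head {us = []} minimizes = minimizes
  validR-head {us = _ ∷ _} (minimizes , _) = minimizes

  validR-tail : ∀ {L K u us} → ValidR d r L K (u ∷ us) → ValidR d r (antipode d r u ∷ L) (u ∷ K) us
  validR-tail {us = []} _ = tt
  validR-tail {us = _ ∷ _} (_ , _ , _ , valid) = valid

  halted⇒central : ∀ {L K} us → ValidR d r L K us → HaltedR d r L K us → Any Central K ⊎ Any Central us
  halted⇒central {L} (u ∷ []) minimizes (inj₁ ecc≡eL) =
    inj₂ (here (eL-lower-bound⇒central L (λ v → ≤-trans (≤-reflexive ecc≡eL) (minimizes v))))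
  halted⇒central {L} (u ∷ []) _ (inj₂ (here bound)) = inj₂ (here (eL-lower-bound⇒central (antipode d r u ∷ L) bound))
  halted⇒central {L} (u ∷ []) _ (inj₂ (there check)) = inj₁ (Any.map (eL-lower-bound⇒central (antipode d r u ∷ L)) check)
  halted⇒central (u ∷ u′ ∷ us) (_ , _ , _ , valid) halted with halted⇒central (u′ ∷ us) valid halted
  ... | inj₁ (here central) = inj₂ (here central)
  ... | inj₁ (there central) = inj₁ central
  ... | inj₂ central = inj₂ (there central)

  module _ (p q : ℕ) where

    Good : Fin (suc m) → Set
    Good u = ecc d u * q ≤ (q + p) * rad d

    central⇒good : ∀ {u} → Central u → Good u
    central⇒good {u} central = begin
      ecc d u * q  ≤⟨ *-monoˡ-≤ q central ⟩
      rad d * q    ≡⟨ *-comm (rad d) q ⟩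
      q * rad d    ≤⟨ *-monoˡ-≤ (rad d) (m≤m+n q p) ⟩
      (q + p) * rad d ∎
      where open ≤-Reasoning

    q≤p⇒good : q ≤ p → ∀ u → Good u
    q≤p⇒good q≤p u = begin
      ecc d u * q                 ≤⟨ *-monoˡ-≤ q ecc≤2rad ⟩
      (rad d + rad d) * q         ≡⟨ *-distribʳ-+ q (rad d) (rad d) ⟩
      rad d * q + rad d * q       ≤⟨ +-monoʳ-≤ (rad d * q) (*-monoʳ-≤ (rad d) q≤p) ⟩
      rad d * q + rad d * p       ≡⟨ sym (*-distribˡ-+ (rad d) q p) ⟩
      rad d * (q + p)             ≡⟨ *-comm (rad d) (q + p) ⟩
      (q + p) * rad d             ∎
      where
        open ≤-Reasoning
        ecc≤2rad : ecc d u ≤ rad d + rad d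
        ecc≤2rad = ≤-trans (ecc-triangle u c)
          (+-mono-≤ (≤-trans (≤-reflexive (d-sym u c)) (≤-trans (d≤ecc c u) (proj₂ centre))) (proj₂ centre))

    antipode-separated : ∀ {L u x} → MinimizesEL d r L u → x ∈ L → ¬ Good u →
                         Separated d p q (rad d) x (antipode d r u)
    antipode-separated {L} {u} {x} minimizes x∈L bad = +-cancelˡ-< (q * rad d) (p * rad d) (q * d x a) (begin-strict
      q * rad d + p * rad d   ≡⟨ sym (*-distribʳ-+ (rad d) q p) ⟩
      (q + p) * rad d         <⟨ ≰⇒> bad ⟩
      ecc d u * q             ≤⟨ *-monoˡ-≤ q ecc≤ ⟩
      (rad d + d x a) * q     ≡⟨ *-comm (rad d + d x a) q ⟩
      q * (rad d + d x a)     ≡⟨ *-distribˡ-+ q (rad d) (d x a) ⟩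
      q * rad d + q * d x a   ∎)
      where
        open ≤-Reasoning
        a = antipode d r u
        ecc≤ : ecc d u ≤ rad d + d x a
        ecc≤ = begin
          ecc d u         ≤⟨ ecc-lub u (antipode-farthest d r u) ⟩
          d u a           ≤⟨ d-triangle u x a ⟩
          d u x + d x a   ≤⟨ +-monoˡ-≤ (d x a) (≤-trans (d≤eL u x∈L) (≤-trans (minimizes c) (eL-centre≤rad L))) ⟩
          rad d + d x a   ∎

    later-antipodes-separated : ∀ {L K x} us → ValidR d r L K us → x ∈ L → All (∁ Good) us →
                                All (Separated d p q (rad d) x ∘′ antipode d r) us
    later-antipodes-separated [] _ _ [] = []
    later-antipodes-separated (u ∷ us) valid x∈L (bad ∷ bads) =
      antipode-separated (validR-head valid) x∈L bad ∷ later-antipodes-separated us (validR-tail valid) (there x∈L) bads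

    antipodes-separated : ∀ {L K} us → ValidR d r L K us → All (∁ Good) us →
                          AllPairs (Separated d p q (rad d)) (map (antipode d r) us)
    antipodes-separated [] _ [] = []
    antipodes-separated (u ∷ us) valid (bad ∷ bads) =
      All-map⁺ (later-antipodes-separated us (validR-tail valid) (here refl) bads) ∷
      antipodes-separated us (validR-tail valid) bads

    algorithmR-selects-good : ∀ {γ} → Doubling d γ → 1 ≤ p → ∀ us → ValidR d r [] [] us →
      (length us ≡ iterBound 2 γ (ceilLog2Frac (2 * q) p +ℤ ⁺ 1)
        ⊎ (length us < iterBound 2 γ (ceilLog2Frac (2 * q) p +ℤ ⁺ 1) × HaltedR d r [] [] us)) →
      Any Good us
    algorithmR-selects-good doubling 1≤p us valid (inj₁ len) =
      Packing.budget-exhausted sym-adj spd doubling p q 1≤p (λ u → ecc d u * q ≤? (q + p) * rad d) q≤p⇒good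
        (antipode d r) c (rad d) (λ u → ≤-trans (d≤ecc c _) (proj₂ centre)) us (antipodes-separated us valid) len
    algorithmR-selects-good doubling 1≤p us valid (inj₂ (_ , halted)) with halted⇒central us valid halted
    ... | inj₁ ()
    ... | inj₂ central = Any.map central⇒good central

module AlgorithmD {m : ℕ} {adj : Fin (suc m) → Fin (suc m) → Bool} {d : Fin (suc m) → Fin (suc m) → ℕ}
  (sym-adj : Symmetric adj) (spd : IsShortestPathDist adj d) where

  open ShortestPath sym-adj spd

  infix 4 _≤∞_
  _≤∞_ : Maybe ℕ → Maybe ℕ → Set
  _≤∞_ = _≤M_ d

  ≤∞-trans : ∀ {a b c} → a ≤∞ b → b ≤∞ c → a ≤∞ c
  ≤∞-trans {c = nothing} _ _ = tt
  ≤∞-trans {just a} {just b} {just c} a≤b b≤c = ≤-trans a≤b b≤c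

  eU-upper : ∀ {U x} v → x ∈ U → eU d U v ≤∞ just (d v x + ecc d x)
  eU-upper {y ∷ U} v (here refl) with eU d U v
  ... | nothing = ≤-refl
  ... | just e = m⊓n≤m _ e
  eU-upper {y ∷ U} v (there x∈U) = ≤∞-trans {eU d (y ∷ U) v} {eU d U v} (minM-≤ʳ (eU d U v)) (eU-upper v x∈U)
    where
      minM-≤ʳ : ∀ e → minM d (just (d v y + ecc d y)) e ≤∞ e
      minM-≤ʳ nothing = tt
      minM-≤ʳ (just e) = m⊓n≤n _ e

  eU-lower : ∀ U v {a} → (∀ x → a ≤ d v x + ecc d x) → just a ≤∞ eU d U v
  eU-lower [] v bound = tt
  eU-lower (y ∷ U) v bound with eU d U v | eU-lower U v bound
  ... | nothing | _ = bound y
  ... | just e | a≤e = ⊓-glb (bound y) a≤e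

  Peripheral : Fin (suc m) → Set
  Peripheral u = diam d ≤ ecc d u

  peripheral : ∃ Peripheral
  peripheral = foldr-⊔-attained (ecc d) Fin.zero (allFin (suc m))

  s : Fin (suc m)
  s = proj₁ peripheral

  ecc≤diam : ∀ v → ecc d v ≤ diam d
  ecc≤diam v = foldr-⊔-upper (ecc d) 0 (∈-allFin v)

  diam≤eU-peripheral : ∀ U → just (diam d) ≤∞ eU d U s
  diam≤eU-peripheral U = eU-lower U s (λ x → ≤-trans (proj₂ peripheral) (ecc-triangle s x))

  eU-upper-bound⇒peripheral : ∀ U {w} → (∀ v → eU d U v ≤∞ just (ecc d w)) → Peripheral w
  eU-upper-bound⇒peripheral U bound = ≤∞-trans {b = eU d U s} (diam≤eU-peripheral U) (bound s)

  diam≤eU-maximizer : ∀ {U u x} → MaximizesEU d U u → x ∈ U → diam d ≤ d u x + ecc d x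
  diam≤eU-maximizer {U} {u} maximizes x∈U =
    ≤∞-trans {b = eU d U u} (≤∞-trans {b = eU d U s} (diam≤eU-peripheral U) (maximizes s)) (eU-upper u x∈U)

  validD-head : ∀ {U K u x ps} → ValidD d U K ((u , x) ∷ ps) → MaximizesEU d U u × d u x + ecc d x ≡ ecc d u
  validD-head {ps = []} head = head
  validD-head {ps = _ ∷ _} (maximizes , x-realizes , _) = maximizes , x-realizes

  validD-tail : ∀ {U K u x ps} → ValidD d U K ((u , x) ∷ ps) → ValidD d (x ∷ U) (u ∷ K) ps
  validD-tail {ps = []} _ = tt
  validD-tail {ps = _ ∷ _} (_ , _ , _ , valid) = valid

  halted⇒peripheral : ∀ {U K} ps → ValidD d U K ps → HaltedD d U K ps →
                      Any Peripheral K ⊎ Any (Peripheral ∘′ proj₁) ps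
  halted⇒peripheral {U} ((u , x) ∷ []) _ (here bound) = inj₂ (here (eU-upper-bound⇒peripheral (x ∷ U) bound))
  halted⇒peripheral {U} ((u , x) ∷ []) _ (there check) = inj₁ (Any.map (eU-upper-bound⇒peripheral (x ∷ U)) check)
  halted⇒peripheral ((u , x) ∷ p′ ∷ ps) (_ , _ , _ , valid) halted with halted⇒peripheral (p′ ∷ ps) valid halted
  ... | inj₁ (here periph) = inj₂ (here periph)
  ... | inj₁ (there periph) = inj₁ periph
  ... | inj₂ periph = inj₂ (there periph)

  module _ (p q : ℕ) where

    Good : Fin (suc m) → Set
    Good u = q * diam d ≤ ecc d u * q + p * diam d

    peripheral⇒good : ∀ {u} → Peripheral u → Good u
    peripheral⇒good {u} periph = ≤-trans (subst (_≤ ecc d u * q) (*-comm (diam d) q) (*-monoˡ-≤ q periph)) (m≤m+n _ _)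

    q≤p⇒good : q ≤ p → ∀ u → Good u
    q≤p⇒good q≤p u = ≤-trans (*-monoˡ-≤ (diam d) q≤p) (m≤n+m _ _)

    selected-separated : ∀ {U ui x uj} → MaximizesEU d U uj → x ∈ U → d ui x + ecc d x ≡ ecc d ui →
                         ¬ Good ui → Separated d p q (diam d) ui uj
    selected-separated {U} {ui} {x} {uj} maximizes x∈U x-realizes bad =
      +-cancelˡ-< (q * ecc d ui) (p * diam d) (q * d ui uj) (begin-strict
        q * ecc d ui + p * diam d   ≡⟨ cong (_+ p * diam d) (*-comm q (ecc d ui)) ⟩
        ecc d ui * q + p * diam d   <⟨ ≰⇒> bad ⟩
        q * diam d                  ≤⟨ *-monoʳ-≤ q diam≤ ⟩
        q * (d ui uj + ecc d ui)    ≡⟨ *-distribˡ-+ q (d ui uj) (ecc d ui) ⟩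
        q * d ui uj + q * ecc d ui  ≡⟨ +-comm (q * d ui uj) _ ⟩
        q * ecc d ui + q * d ui uj  ∎)
      where
        open ≤-Reasoning
        diam≤ : diam d ≤ d ui uj + ecc d ui
        diam≤ = begin
          diam d                          ≤⟨ diam≤eU-maximizer maximizes x∈U ⟩
          d uj x + ecc d x                ≤⟨ +-monoˡ-≤ (ecc d x) (d-triangle uj ui x) ⟩
          d uj ui + d ui x + ecc d x      ≡⟨ +-assoc (d uj ui) (d ui x) (ecc d x) ⟩
          d uj ui + (d ui x + ecc d x)    ≡⟨ cong₂ _+_ (d-sym uj ui) x-realizes ⟩
          d ui uj + ecc d ui              ∎

    later-selected-separated : ∀ {U K ui x} ps → ValidD d U K ps → x ∈ U → d ui x + ecc d x ≡ ecc d ui →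
                               ¬ Good ui → All (Separated d p q (diam d) ui ∘′ proj₁) ps
    later-selected-separated [] _ _ _ _ = []
    later-selected-separated ((u , x) ∷ ps) valid x∈U x-realizes bad =
      selected-separated (proj₁ (validD-head valid)) x∈U x-realizes bad ∷
      later-selected-separated ps (validD-tail valid) (there x∈U) x-realizes bad

    selected-separated-pairwise : ∀ {U K} ps → ValidD d U K ps → All (∁ Good ∘′ proj₁) ps →
                                  AllPairs (Separated d p q (diam d)) (map proj₁ ps)
    selected-separated-pairwise [] _ [] = []
    selected-separated-pairwise ((u , x) ∷ ps) valid (bad ∷ bads) =
      All-map⁺ (later-selected-separated ps (validD-tail valid) (here refl) (proj₂ (validD-head valid)) bad) ∷
      selected-separated-pairwise ps (validD-tail valid) bads

    algorithmD-selects-good : ∀ {γ} → Doubling d γ → 1 ≤ p → ∀ ps → ValidD d [] [] ps →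
      (length ps ≡ iterBound 2 γ (ceilLog2Frac (2 * q) p +ℤ ⁺ 1)
        ⊎ (length ps < iterBound 2 γ (ceilLog2Frac (2 * q) p +ℤ ⁺ 1) × HaltedD d [] [] ps)) →
      Any (Good ∘′ proj₁) ps
    algorithmD-selects-good doubling 1≤p ps valid (inj₁ len) =
      Packing.budget-exhausted sym-adj spd doubling p q 1≤p (λ (u , _) → q * diam d ≤? ecc d u * q + p * diam d)
        (λ q≤p (u , _) → q≤p⇒good q≤p u) proj₁ s (diam d) (λ (u , _) → ≤-trans (d≤ecc s u) (ecc≤diam s))
        ps (selected-separated-pairwise ps valid) len
    algorithmD-selects-good doubling 1≤p ps valid (inj₂ (_ , halted)) with halted⇒peripheral ps valid halted
    ... | inj₁ ()
    ... | inj₂ periph = Any.map peripheral⇒good periph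

proposition3 :
    Σ ℕ λ C →
      -- (i) Algorithm R ; ε = p / q
      ((m : ℕ) (adj : Fin (suc m) → Fin (suc m) → Bool) (d : Fin (suc m) → Fin (suc m) → ℕ)
        (r : Fin (suc m) → ℕ) (γ p q : ℕ) →
        Symmetric adj → Irreflexive adj → Connected adj → IsShortestPathDist adj d →
        IsRanking r → Doubling d γ → 1 ≤ p → 1 ≤ q →
        (us : List (Fin (suc m))) → ValidR d r [] [] us →
        (length us ≡ iterBound C γ (ceilLog2Frac (2 * q) p +ℤ ⁺ 1)
          ⊎ (length us < iterBound C γ (ceilLog2Frac (2 * q) p +ℤ ⁺ 1) × HaltedR d r [] [] us)) →
        Any (λ u → ecc d u * q ≤ (q + p) * rad d) us)
      ×
      -- (ii) Algorithm D ; ε = p / q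
      ((m : ℕ) (adj : Fin (suc m) → Fin (suc m) → Bool) (d : Fin (suc m) → Fin (suc m) → ℕ)
        (γ p q : ℕ) →
        Symmetric adj → Irreflexive adj → Connected adj → IsShortestPathDist adj d →
        Doubling d γ → 1 ≤ p → 1 ≤ q →
        (ps : List (Fin (suc m) × Fin (suc m))) → ValidD d [] [] ps →
        (length ps ≡ iterBound C γ (ceilLog2Frac (2 * q) p +ℤ ⁺ 1)
          ⊎ (length ps < iterBound C γ (ceilLog2Frac (2 * q) p +ℤ ⁺ 1) × HaltedD d [] [] ps)) →
        Any (λ ux → q * diam d ≤ ecc d (proj₁ ux) * q + p * diam d) ps)
proposition3 = 2 ,
  (λ m adj d r γ p q sym-adj _ _ spd _ doubling 1≤p _ →
     AlgorithmR.algorithmR-selects-good r sym-adj spd p q doubling 1≤p) ,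
  (λ m adj d γ p q sym-adj _ _ spd doubling 1≤p _ →
     AlgorithmD.algorithmD-selects-good sym-adj spd p q doubling 1≤p)
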